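{- Let $G$ be a bipartite graph with bipartition $(X,Y)$, let $L$ be the set function on $V(G)$ given by $L(x)=\{ -1,1\}$ for $x\in X$ and $L(y)=\{0,2,3,4,\dots\}$ for $y\in Y$, and let $(A_L,B_L,C_L,D_L)$ be the $L$-decomposition of $G$. Then $A_L\subseteq X$ and $B_L=\emptyset$.
   Context: Graphs are finite and simple. For a spanning subgraph $F$ of $G$, its deviation is $\nabla_L(F;G)=\sum_{v\in V(G)}\min\{|d_F(v)-h| : h\in L(v)\}$, and $\nabla_L(G)=\min\{\nabla_L(F;G): F \text{ a spanning subgraph of } G\}$. $F$ is $L$-optimal if $\nabla_L(F;G)=\nabla_L(G)$; an $L$-factor is a spanning subgraph $F$ with $d_F(v)\in L(v)$ for all $v$. For $v\in V(G)$, $I_L(v)=\{d_F(v): F \text{ is } L\text{ -optimal}\}$. The $L$-decomposition is: $C_L=\{v: I_L(v)\subseteq L(v)\}$; $A_L=\{v\notin C_L: \min I_L(v)\geq \max L(v)\}$; $B_L=\{v\notin C_L: \max I_L(v)\leq \min L(v)\}$; $D_L=V(G)\setminus(A_L\cup B_L\cup C_L)$. Here $\max L(y)=+\infty$ for $y\in Y$ (as $L(y)$ is infinite). -}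

module Defs where

open import Data.Nat as ℕ using (ℕ)
open import Data.Integer as ℤ using (ℤ; +_; -[1+_]; ∣_∣; _-_)
open import Data.Fin using (Fin)
open import Data.Bool using (Bool; true; false; if_then_else_)
open import Data.List using (List; map; allFin)
open import Data.Nat.ListAction using (sum)
open import Data.Product using (Σ; _×_; ∃)
open import Data.Sum using (_⊎_)
open import Relation.Binary.PropositionalEquality using (_≡_; _≢_)
open import Relation.Nullary using (¬_)

record Graph (n : ℕ) : Set where
  field
    adj   : Fin n → Fin n → Bool
    sym   : ∀ i j → adj i j ≡ adj j i
    irrefl : ∀ i → adj i i ≡ false
open Graph public

-- (X , Y) is a bipartition of G, encoded by side : X = side⁻¹(true), Y = side⁻¹(false).
IsBipartition : ∀ {n} → Graph n → (Fin n → Bool) → Set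
IsBipartition G side = ∀ i j → adj G i j ≡ true → side i ≢ side j

InX InY : ∀ {n} → (Fin n → Bool) → Fin n → Set
InX side v = side v ≡ true
InY side v = side v ≡ false

record Spanning {n : ℕ} (G : Graph n) : Set where
  field
    fadj : Fin n → Fin n → Bool
    fsym : ∀ i j → fadj i j ≡ fadj j i
    fsub : ∀ i j → fadj i j ≡ true → adj G i j ≡ true
open Spanning public

deg : ∀ {n} {G : Graph n} → Spanning G → Fin n → ℕ
deg {n} F v = sum (map (λ j → if fadj F v j then 1 else 0) (allFin n))

L : ∀ {n} → (Fin n → Bool) → Fin n → ℤ → Set
L side v h with side v
... | true  = (h ≡ -[1+ 0 ]) ⊎ (h ≡ + 1)
... | false = (h ≡ + 0) ⊎ (ℤ._≤_ (+ 2) h)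

IsMinDist : (ℤ → Set) → ℕ → ℕ → Set
IsMinDist P d c =
  (Σ ℤ λ h → P h × ∣ + d - h ∣ ≡ c) × (∀ h → P h → c ℕ.≤ ∣ + d - h ∣)

IsCost : ∀ {n} → (Fin n → Bool) → (Fin n → ℕ → ℕ) → Set
IsCost side cost = ∀ v d → IsMinDist (L side v) d (cost v d)

dev : ∀ {n} {G : Graph n} → (Fin n → ℕ → ℕ) → Spanning G → ℕ
dev {n} cost F = sum (map (λ v → cost v (deg F v)) (allFin n))

Optimal : ∀ {n} {G : Graph n} → (Fin n → ℕ → ℕ) → Spanning G → Set
Optimal {G = G} cost F = ∀ (F' : Spanning G) → dev cost F ℕ.≤ dev cost F'

InI : ∀ {n} (G : Graph n) → (Fin n → ℕ → ℕ) → Fin n → ℕ → Set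
InI G cost v d = Σ (Spanning G) λ F → Optimal cost F × deg F v ≡ d

module Decomposition {n : ℕ} (G : Graph n) (side : Fin n → Bool) (cost : Fin n → ℕ → ℕ) where
  C : Fin n → Set
  C v = ∀ d → InI G cost v d → L side v (+ d)
  -- A_L : v ∉ C_L and min I_L(v) ≥ max L(v)   (max L(v) = +∞ if L(v) unbounded,
  -- rendered as: every element of I_L(v) is ≥ every element of L(v))
  A : Fin n → Set
  A v = ¬ C v × (∀ d → InI G cost v d → ∀ h → L side v h → ℤ._≤_ h (+ d))
  B : Fin n → Set
  B v = ¬ C v × (∀ d → InI G cost v d → ∀ h → L side v h → ℤ._≤_ (+ d) h)
  D : Fin n → Set
  D v = ¬ A v × ¬ B v × ¬ C v

-- The claims depend only on the shape of L, since degrees are nonnegative. For y ∈ Y the set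
-- L(y) is unbounded above, so no degree dominates it and a vertex of A_L would have empty
-- I_L(y), putting it in C_L. A degree d below every element of L(v) forces v ∈ Y (as -1 ∈ L(x)
-- for x ∈ X) and then d ≤ 0, i.e. d = 0 ∈ L(v); hence a vertex with max I_L(v) ≤ min L(v) lies
-- in C_L, so B_L = ∅.
module Submission where

open import Defs
open import Data.Nat using (ℕ; suc; s≤s; z≤n)
open import Data.Nat.Properties using (1+n≰n; m+n≤o⇒n≤o; n≤0⇒n≡0)
open import Data.Integer using (+_; -[1+_]; _≤_; +≤+)
open import Data.Integer.Properties using (drop‿+≤+)
open import Data.Fin using (Fin)
open import Data.Bool using (Bool; true; false)
open import Data.Bool.Properties using (¬-not)
open import Data.Product using (_×_; _,_)
open import Data.Sum using (inj₁; inj₂)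
open import Data.Empty using (⊥-elim)
open import Relation.Nullary using (¬_)
open import Relation.Binary.PropositionalEquality using (refl; cong)

module _ {n : ℕ} (side : Fin n → Bool) (v : Fin n) where

  L-unbounded-on-Y : InY side v → ∀ d → ¬ (∀ h → L side v h → h ≤ + d)
  L-unbounded-on-Y v∈Y d ub with side v
  L-unbounded-on-Y () d ub | true
  L-unbounded-on-Y v∈Y d ub | false =
    1+n≰n (m+n≤o⇒n≤o 1 (drop‿+≤+ (ub (+ suc (suc d)) (inj₂ (+≤+ (s≤s (s≤s z≤n)))))))

  lowerBound-of-L∈L : ∀ d → (∀ h → L side v h → + d ≤ h) → L side v (+ d)
  lowerBound-of-L∈L d lb with side v
  lowerBound-of-L∈L d lb | true with lb -[1+ 0 ] (inj₁ refl)
  ... | ()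
  lowerBound-of-L∈L d lb | false = inj₁ (cong +_ (n≤0⇒n≡0 (drop‿+≤+ (lb (+ 0) (inj₁ refl)))))

module _ {n : ℕ} (G : Graph n) (side : Fin n → Bool) (cost : Fin n → ℕ → ℕ) where
  open Decomposition G side cost

  A⇒InX : ∀ v → A v → InX side v
  A⇒InX v (v∉C , I≥L) =
    ¬-not λ v∈Y → v∉C λ d d∈I → ⊥-elim (L-unbounded-on-Y side v v∈Y d (I≥L d d∈I))

  B-empty : ∀ v → ¬ B v
  B-empty v (v∉C , I≤L) = v∉C λ d d∈I → lowerBound-of-L∈L side v d (I≤L d d∈I)

lemma3p1 : ∀ {n : ℕ} (G : Graph n) (side : Fin n → Bool) (cost : Fin n → ℕ → ℕ)
    → IsBipartition G side → IsCost side cost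
    → (∀ v → Decomposition.A G side cost v → InX side v)
      × (∀ v → ¬ Decomposition.B G side cost v)
lemma3p1 G side cost _ _ = A⇒InX G side cost , B-empty G side cost
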